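{- Let $N$ be a finite set, $c\in\mathbb{R}^N_{\ge0}$, $\lambda\in(0,1]$, $Q\subseteq\mathbb{R}^N_{\ge0}$ a polyhedron, $Z\subseteq Q$, and $R\subseteq\mathbb{R}^N$ a convex set containing the origin. Suppose we are given a $(Q,Z)$-face-preserving rounding algorithm with error body $R$. Given $x\in Q$, let $y^*$ be an optimal solution of $\min\{c^Ty: y\in Q\cap(x-\lambda R)\}$ (assumed to be attained), and let $z\in Z$ be the output of the $(Q,Z)$-FPRA applied to $y^*$. Then $c^Tz\le\frac1\lambda c^Tx$ and $z\in x+(R-\lambda R)$.
   Context: For sets, $\lambda R=\{\lambda r:r\in R\}$, $x-\lambda R=\{x-\lambda r:r\in R\}$ and $x+(R-\lambda R)=\{x+r_1-\lambda r_2:r_1,r_2\in R\}$. A $(Q,Z)$-face-preserving rounding algorithm (FPRA) with error body $R$, where $Q\subseteq\mathbb{R}^N$ is a polyhedron, $Z\subseteq Q$, and $R\subseteq\mathbb{R}^N$ is a convex set containing the origin, is an algorithm that takes as input a point $x\in Q$ and returns a point $z\in Z$ with $z-x\in R$ such that $z$ lies on the minimal face of $Q$ containing $x$. -}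

module Defs where

open import Level using (0ℓ)
open import Data.Nat using (ℕ; zero; suc)
open import Data.Fin using (Fin; zero; suc)
open import Data.Product using (Σ; ∃; ∃-syntax; _×_; _,_)
open import Relation.Nullary using (¬_)
open import Relation.Binary.PropositionalEquality using (_≡_; sym)
open import Algebra.Structures using (IsCommutativeRing)
open import Relation.Binary.Structures using (IsTotalOrder)

-- The real numbers, axiomatised as a complete ordered field
-- (unique up to isomorphism), since agda-stdlib has no reals.
record RealField : Set₁ where
  infixl 6 _+_
  infixl 7 _*_
  infix  4 _≤_ _<_
  field
    ℝ   : Set
    0#  : ℝ
    1#  : ℝ
    _+_ : ℝ → ℝ → ℝ
    _*_ : ℝ → ℝ → ℝ
    -_  : ℝ → ℝ
    _≤_ : ℝ → ℝ → Set
    inv : (x : ℝ) → ¬ (x ≡ 0#) → ℝ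
    isCommutativeRing : IsCommutativeRing _≡_ _+_ _*_ -_ 0# 1#
    0≢1     : ¬ (0# ≡ 1#)
    inv-r   : (x : ℝ) (p : ¬ (x ≡ 0#)) → x * inv x p ≡ 1#
    isTotalOrder : IsTotalOrder _≡_ _≤_
    +-mono-≤ : ∀ {x y} z → x ≤ y → x + z ≤ y + z
    *-nonneg : ∀ {x y} → 0# ≤ x → 0# ≤ y → 0# ≤ x * y
    complete : (S : ℝ → Set) → (∃[ s ] S s) →
               (∃[ u ] (∀ s → S s → s ≤ u)) →
               ∃[ u ] ((∀ s → S s → s ≤ u) ×
                       (∀ v → (∀ s → S s → s ≤ v) → u ≤ v))

  _<_ : ℝ → ℝ → Set
  x < y = (x ≤ y) × ¬ (x ≡ y)

module Geometry (F : RealField) where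
  open RealField F public

  invPos : (x : ℝ) → 0# < x → ℝ
  invPos x (_ , x≢0) = inv x (λ e → x≢0 (sym e))

  -- ℝ^N for N = Fin n
  Vec : ℕ → Set
  Vec n = Fin n → ℝ

  Subset : ℕ → Set₁
  Subset n = Vec n → Set

  sum : ∀ {n} → (Fin n → ℝ) → ℝ
  sum {zero}  f = 0#
  sum {suc n} f = f zero + sum (λ i → f (suc i))

  _·_ : ∀ {n} → Vec n → Vec n → ℝ
  a · y = sum (λ i → a i * y i)

  _⊆_ : ∀ {n} → Subset n → Subset n → Set
  A ⊆ B = ∀ y → A y → B y

  Nonneg : ∀ {n} → Vec n → Set
  Nonneg y = ∀ i → 0# ≤ y i

  IsPolyhedron : ∀ {n} → Subset n → Set
  IsPolyhedron {n} Q =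
    Σ ℕ λ m → Σ (Fin m → Vec n) λ A → Σ (Fin m → ℝ) λ b →
      ∀ y → (Q y → ∀ j → A j · y ≤ b j) × ((∀ j → A j · y ≤ b j) → Q y)

  IsConvex : ∀ {n} → Subset n → Set
  IsConvex R = ∀ r s t → R r → R s → 0# ≤ t → t ≤ 1# →
               R (λ i → t * r i + (1# + - t) * s i)

  zeroV : ∀ {n} → Vec n
  zeroV _ = 0#

  -- Faces of Q: sets Q ∩ {y : a·y = β} for an inequality a·y ≤ β valid on Q
  -- (a = 0, β = 0 gives Q itself).  z lies on the minimal face of Q
  -- containing x iff z lies in every face of Q containing x.
  InMinimalFace : ∀ {n} → Subset n → Vec n → Vec n → Set
  InMinimalFace Q x z =
    Q z × (∀ a β → (∀ y → Q y → a · y ≤ β) → a · x ≡ β → a · z ≡ β)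

  IsFPRA : ∀ {n} (Q Z R : Subset n) →
           ((x : Vec n) → Q x → Vec n) → Set
  IsFPRA Q Z R alg = ∀ x (qx : Q x) →
    Z (alg x qx) × R (λ i → alg x qx i + - x i) × InMinimalFace Q x (alg x qx)

  _-_·R_ : ∀ {n} → Vec n → ℝ → Subset n → Subset n
  (x - l ·R R) y = ∃[ r ] (R r × (∀ i → y i ≡ x i + - (l * r i)))

  _+[_-_·_] : ∀ {n} → Vec n → Subset n → ℝ → Subset n → Subset n
  (x +[ R - l · R' ]) z =
    ∃[ r₁ ] ∃[ r₂ ] (R r₁ × R' r₂ × (∀ i → z i ≡ x i + r₁ i + - (l * r₂ i)))

{-# OPTIONS --safe #-}
-- Let p = x - λ(z - y*), the point of x - λR determined by the rounding error
-- z - y* ∈ R.  By convexity the segment from y* to p stays in x - λR, and for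
-- small steps it also stays in Q: every constraint of Q tight at y* is tight at z,
-- since z lies on the minimal face of Q containing y*, so it holds at p because
-- it holds at x.  Optimality of y* therefore gives
-- c·y* ≤ c·p = c·x - λ(c·z - c·y*), i.e. λ c·z ≤ c·x - (1 - λ) c·y* ≤ c·x.
-- Constructively the step size is only found under a double negation (whether a
-- constraint is tight cannot be decided); it is removed at the end because ≤ is
-- ¬¬-stable in a complete ordered field.
module Submission where

open import Defs
open import Level using (0ℓ)
open import Data.Nat using (ℕ; zero; suc)
open import Data.Fin using (Fin; zero; suc)
open import Data.Product using (_×_; _,_; proj₁; proj₂; ∃-syntax)
open import Data.Sum using (inj₁; inj₂)
open import Function using (_∘_)
open import Algebra.Bundles using (CommutativeRing)
open import Effect.Monad using (RawMonad)
open import Relation.Binary.Bundles using (Poset)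
open import Relation.Binary.Structures using (IsTotalOrder)
open import Relation.Binary.PropositionalEquality using (_≡_; refl; sym; trans; cong; cong₂; subst; subst₂)
open import Relation.Nullary using (¬_; Dec; yes; no)
open import Relation.Nullary.Decidable using (¬¬-excluded-middle)
open import Relation.Nullary.Negation using (Stable; ¬¬-Monad; ¬¬-map; contradiction)

module FieldProperties (F : RealField) where
  open RealField F renaming (+-mono-≤ to +-monoˡ-≤)
  open Geometry F using (invPos)

  commutativeRing : CommutativeRing 0ℓ 0ℓ
  commutativeRing = record { isCommutativeRing = isCommutativeRing }

  open CommutativeRing commutativeRing public
    using ( _-_; +-assoc; +-comm; +-identityˡ; +-identityʳ; -‿inverseˡ; -‿inverseʳ
          ; *-assoc; *-comm; *-identityˡ; *-identityʳ; distribˡ; distribʳ; zeroˡ; zeroʳ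
          ; +-commutativeSemigroup; *-commutativeSemigroup; ring; semiring)
  open import Algebra.Properties.Ring ring public
    using (x[y-z]≈xy-xz; [y-z]x≈yx-zx; -1*x≈-x; -‿involutive; -‿+-comm; -0#≈0#)
  open import Algebra.Properties.CommutativeSemigroup +-commutativeSemigroup public
    using (interchange; xy∙z≈xz∙y)
  open import Algebra.Properties.CommutativeSemigroup *-commutativeSemigroup public
    using (x∙yz≈y∙xz)
  open import Algebra.Properties.Semiring.Mult semiring
    using (×-congʳ; ×-comm-*) renaming (_×_ to _×ₙ_)
  open IsTotalOrder isTotalOrder public
    using (total) renaming (refl to ≤-refl; trans to ≤-trans; antisym to ≤-antisym)

  ≤-poset : Poset 0ℓ 0ℓ 0ℓ
  ≤-poset = record { isPartialOrder = IsTotalOrder.isPartialOrder isTotalOrder }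

  open import Relation.Binary.Reasoning.PartialOrder ≤-poset public
  open RawMonad (¬¬-Monad {0ℓ}) using (pure; _>>=_)

  x+[y-x]≡y : ∀ x y → x + (y - x) ≡ y
  x+[y-x]≡y x y = begin-equality
    x + (y - x)   ≡⟨ cong (x +_) (+-comm y (- x)) ⟩
    x + (- x + y) ≡⟨ +-assoc x (- x) y ⟨
    x - x + y     ≡⟨ cong (_+ y) (-‿inverseʳ x) ⟩
    0# + y        ≡⟨ +-identityˡ y ⟩
    y             ∎

  x+y-y≡x : ∀ x y → x + y - y ≡ x
  x+y-y≡x x y = trans (+-assoc x y (- y)) (trans (cong (x +_) (-‿inverseʳ y)) (+-identityʳ x))

  x-y+y≡x : ∀ x y → x - y + y ≡ x
  x-y+y≡x x y = trans (+-assoc x (- y) y) (trans (cong (x +_) (-‿inverseˡ y)) (+-identityʳ x))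

  t*x+[1-t]*x≡x : ∀ t x → t * x + (1# - t) * x ≡ x
  t*x+[1-t]*x≡x t x = trans (sym (distribʳ x t (1# - t))) (trans (cong (_* x) (x+[y-x]≡y t 1#)) (*-identityˡ x))

  t*v+[1-t]*u≡u+t*[v-u] : ∀ t u v → t * v + (1# - t) * u ≡ u + t * (v - u)
  t*v+[1-t]*u≡u+t*[v-u] t u v = begin-equality
    t * v + (1# - t) * u          ≡⟨ cong (t * v +_) ([y-z]x≈yx-zx u 1# t) ⟩
    t * v + (1# * u - t * u)      ≡⟨ cong (λ w → t * v + (w - t * u)) (*-identityˡ u) ⟩
    t * v + (u - t * u)           ≡⟨ +-comm (t * v) (u - t * u) ⟩
    u - t * u + t * v             ≡⟨ xy∙z≈xz∙y u (- (t * u)) (t * v) ⟩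
    u + t * v - t * u             ≡⟨ +-assoc u (t * v) (- (t * u)) ⟩
    u + (t * v - t * u)           ≡⟨ cong (u +_) (x[y-z]≈xy-xz t v u) ⟨
    u + t * (v - u)               ∎

  +-monoʳ-≤ : ∀ z {x y} → x ≤ y → z + x ≤ z + y
  +-monoʳ-≤ z {x} {y} x≤y = begin
    z + x ≡⟨ +-comm z x ⟩
    x + z ≤⟨ +-monoˡ-≤ z x≤y ⟩
    y + z ≡⟨ +-comm y z ⟩
    z + y ∎

  +-mono-≤ : ∀ {x y u v} → x ≤ y → u ≤ v → x + u ≤ y + v
  +-mono-≤ {y = y} {u} x≤y u≤v = ≤-trans (+-monoˡ-≤ u x≤y) (+-monoʳ-≤ y u≤v)

  +-cancelʳ-≤ : ∀ z {x y} → x + z ≤ y + z → x ≤ y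
  +-cancelʳ-≤ z {x} {y} x+z≤y+z = begin
    x         ≡⟨ x+y-y≡x x z ⟨
    x + z - z ≤⟨ +-monoˡ-≤ (- z) x+z≤y+z ⟩
    y + z - z ≡⟨ x+y-y≡x y z ⟩
    y         ∎

  +-cancelˡ-≤ : ∀ z {x y} → z + x ≤ z + y → x ≤ y
  +-cancelˡ-≤ z {x} {y} z+x≤z+y = +-cancelʳ-≤ z (subst₂ _≤_ (+-comm z x) (+-comm z y) z+x≤z+y)

  x≤y⇒0≤y-x : ∀ {x y} → x ≤ y → 0# ≤ y - x
  x≤y⇒0≤y-x {x} {y} x≤y = begin
    0#    ≡⟨ -‿inverseʳ x ⟨
    x - x ≤⟨ +-monoˡ-≤ (- x) x≤y ⟩
    y - x ∎

  0≤y-x⇒x≤y : ∀ {x y} → 0# ≤ y - x → x ≤ y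
  0≤y-x⇒x≤y {x} {y} 0≤y-x = +-cancelʳ-≤ (- x) (subst₂ _≤_ (sym (-‿inverseʳ x)) refl 0≤y-x)

  *-monoˡ-≤ : ∀ {c x y} → 0# ≤ c → x ≤ y → c * x ≤ c * y
  *-monoˡ-≤ {c} {x} {y} 0≤c x≤y =
    0≤y-x⇒x≤y (subst₂ _≤_ refl (x[y-z]≈xy-xz c y x) (*-nonneg 0≤c (x≤y⇒0≤y-x x≤y)))

  *-monoʳ-≤ : ∀ {c x y} → 0# ≤ c → x ≤ y → x * c ≤ y * c
  *-monoʳ-≤ {c} {x} {y} 0≤c x≤y = subst₂ _≤_ (*-comm c x) (*-comm c y) (*-monoˡ-≤ 0≤c x≤y)

  -- If 1 ≤ 0 then 0 ≤ -1, and 1 = (-1)(-1) ≥ 0 anyway.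
  0≤1 : 0# ≤ 1#
  0≤1 with total 0# 1#
  ... | inj₁ 0≤1 = 0≤1
  ... | inj₂ 1≤0 = subst₂ _≤_ refl -1*-1≡1 (*-nonneg 0≤-1 0≤-1)
    where
    0≤-1 : 0# ≤ - 1#
    0≤-1 = subst₂ _≤_ (-‿inverseʳ 1#) (+-identityˡ (- 1#)) (+-monoˡ-≤ (- 1#) 1≤0)
    -1*-1≡1 : - 1# * - 1# ≡ 1#
    -1*-1≡1 = trans (-1*x≈-x (- 1#)) (-‿involutive 1#)

  0<1 : 0# < 1#
  0<1 = 0≤1 , 0≢1

  invPos-cancelˡ : ∀ {x} (0<x : 0# < x) y → invPos x 0<x * (x * y) ≡ y
  invPos-cancelˡ {x} 0<x y = begin-equality
    invPos x 0<x * (x * y) ≡⟨ *-assoc (invPos x 0<x) x y ⟨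
    invPos x 0<x * x * y   ≡⟨ cong (_* y) (*-comm (invPos x 0<x) x) ⟩
    x * invPos x 0<x * y   ≡⟨ cong (_* y) (inv-r x _) ⟩
    1# * y                 ≡⟨ *-identityˡ y ⟩
    y                      ∎

  invPos-pos : ∀ {x} (0<x : 0# < x) → 0# < invPos x 0<x
  invPos-pos {x} 0<x@(0≤x , _) = 0≤x⁻¹ , 0≢x⁻¹
    where
    x*x⁻¹≡1 : x * invPos x 0<x ≡ 1#
    x*x⁻¹≡1 = inv-r x _
    0≤x⁻¹ : 0# ≤ invPos x 0<x
    0≤x⁻¹ with total 0# (invPos x 0<x)
    ... | inj₁ 0≤x⁻¹ = 0≤x⁻¹
    ... | inj₂ x⁻¹≤0 = contradiction (≤-antisym 0≤1 1≤0) 0≢1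
      where
      1≤0 : 1# ≤ 0#
      1≤0 = subst₂ _≤_ x*x⁻¹≡1 (zeroʳ x) (*-monoˡ-≤ 0≤x x⁻¹≤0)
    0≢x⁻¹ : ¬ 0# ≡ invPos x 0<x
    0≢x⁻¹ 0≡x⁻¹ = 0≢1 (trans (sym (zeroʳ x)) (trans (cong (x *_) 0≡x⁻¹) x*x⁻¹≡1))

  *-pos : ∀ {x y} → 0# < x → 0# < y → 0# < x * y
  *-pos {x} {y} 0<x@(0≤x , _) (0≤y , 0≢y) = *-nonneg 0≤x 0≤y , 0≢x*y
    where
    0≢x*y : ¬ 0# ≡ x * y
    0≢x*y 0≡x*y = 0≢y (begin-equality
      0#                     ≡⟨ zeroʳ (invPos x 0<x) ⟨
      invPos x 0<x * 0#      ≡⟨ cong (invPos x 0<x *_) 0≡x*y ⟩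
      invPos x 0<x * (x * y) ≡⟨ invPos-cancelˡ 0<x y ⟩
      y                      ∎)

  x*y≤z⇒y≤x⁻¹*z : ∀ {x y z} (0<x : 0# < x) → x * y ≤ z → y ≤ invPos x 0<x * z
  x*y≤z⇒y≤x⁻¹*z {x} {y} {z} 0<x x*y≤z = begin
    y                      ≡⟨ invPos-cancelˡ 0<x y ⟨
    invPos x 0<x * (x * y) ≤⟨ *-monoˡ-≤ (proj₁ (invPos-pos 0<x)) x*y≤z ⟩
    invPos x 0<x * z       ∎

  *-cancelˡ-≤ : ∀ {x y z} → 0# < x → x * y ≤ x * z → y ≤ z
  *-cancelˡ-≤ {x} {y} {z} 0<x x*y≤x*z =
    subst₂ _≤_ refl (invPos-cancelˡ 0<x z) (x*y≤z⇒y≤x⁻¹*z 0<x x*y≤x*z)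

  ×ₙ-zeroʳ : ∀ k → k ×ₙ 0# ≡ 0#
  ×ₙ-zeroʳ k = begin-equality
    k ×ₙ 0#        ≡⟨ ×-congʳ k (zeroˡ 0#) ⟨
    k ×ₙ (0# * 0#) ≡⟨ ×-comm-* k 0# 0# ⟨
    0# * k ×ₙ 0#   ≡⟨ zeroˡ (k ×ₙ 0#) ⟩
    0#             ∎

  Multiple : ℝ → ℝ → Set
  Multiple x s = ∃[ k ] s ≡ k ×ₙ x

  -- Archimedean property: if u is the supremum of the multiples of x, then u - x is an upper bound too.
  ×ₙ-bounded⇒≤0 : ∀ {x b} → (∀ k → k ×ₙ x ≤ b) → x ≤ 0#
  ×ₙ-bounded⇒≤0 {x} {b} bounded
    with complete (Multiple x) (0# , 0 , refl) (b , λ { _ (k , refl) → bounded k })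
  ... | u , upper , least = +-cancelˡ-≤ u (begin
      u + x     ≤⟨ +-monoˡ-≤ x (least (u - x) u-x-upper) ⟩
      u - x + x ≡⟨ x-y+y≡x u x ⟩
      u         ≡⟨ +-identityʳ u ⟨
      u + 0#    ∎)
    where
    u-x-upper : ∀ s → Multiple x s → s ≤ u - x
    u-x-upper _ (k , refl) = +-cancelʳ-≤ x (begin
      k ×ₙ x + x ≡⟨ +-comm (k ×ₙ x) x ⟩
      suc k ×ₙ x ≤⟨ upper (suc k ×ₙ x) (suc k , refl) ⟩
      u          ≡⟨ x-y+y≡x u x ⟨
      u - x + x  ∎)

  ≤-stable : ∀ {x y} → Stable (x ≤ y)
  ≤-stable {x} {y} ¬¬x≤y with total x y
  ... | inj₁ x≤y = x≤y
  ... | inj₂ y≤x = +-cancelʳ-≤ (- y) (subst₂ _≤_ refl (sym (-‿inverseʳ y)) (×ₙ-bounded⇒≤0 bounded))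
    where
    bounded : ∀ k → k ×ₙ (x - y) ≤ 1#
    bounded k with total (k ×ₙ (x - y)) 1#
    ... | inj₁ ≤1 = ≤1
    ... | inj₂ 1≤ = contradiction (λ x≤y → 0≢1 (≤-antisym 0≤1 (subst (1# ≤_) (vanishes (≤-antisym x≤y y≤x)) 1≤))) ¬¬x≤y
      where
      vanishes : x ≡ y → k ×ₙ (x - y) ≡ 0#
      vanishes refl = trans (cong (k ×ₙ_) (-‿inverseʳ y)) (×ₙ-zeroʳ k)

  t*[x-l*r]+[1-t]*[x-l*s]≡x-l*[t*r+[1-t]*s] : ∀ t x l r s →
    t * (x - l * r) + (1# - t) * (x - l * s) ≡ x - l * (t * r + (1# - t) * s)
  t*[x-l*r]+[1-t]*[x-l*s]≡x-l*[t*r+[1-t]*s] t x l r s = begin-equality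
    t * (x - l * r) + (1# - t) * (x - l * s)
      ≡⟨ cong₂ _+_ (x[y-z]≈xy-xz t x (l * r)) (x[y-z]≈xy-xz (1# - t) x (l * s)) ⟩
    (t * x - t * (l * r)) + ((1# - t) * x - (1# - t) * (l * s))
      ≡⟨ interchange (t * x) (- (t * (l * r))) ((1# - t) * x) (- ((1# - t) * (l * s))) ⟩
    (t * x + (1# - t) * x) + (- (t * (l * r)) - (1# - t) * (l * s))
      ≡⟨ cong₂ _+_ (t*x+[1-t]*x≡x t x) (-‿+-comm (t * (l * r)) ((1# - t) * (l * s))) ⟩
    x - (t * (l * r) + (1# - t) * (l * s))
      ≡⟨ cong (λ w → x - w) (cong₂ _+_ (x∙yz≈y∙xz t l r) (x∙yz≈y∙xz (1# - t) l s)) ⟩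
    x - (l * (t * r) + l * ((1# - t) * s))
      ≡⟨ cong (λ w → x - w) (distribˡ l (t * r) ((1# - t) * s)) ⟨
    x - l * (t * r + (1# - t) * s)
      ∎

  y≡x-w⇒z≡x+[z-y]-w : ∀ {x y z w} → y ≡ x - w → z ≡ x + (z - y) - w
  y≡x-w⇒z≡x+[z-y]-w {x} {y} {z} {w} y≡x-w = sym (begin-equality
    x + (z - y) - w ≡⟨ xy∙z≈xz∙y x (z - y) (- w) ⟩
    x - w + (z - y) ≡⟨ cong (_+ (z - y)) y≡x-w ⟨
    y + (z - y)     ≡⟨ x+[y-x]≡y y z ⟩
    z               ∎)

  y≤x-l*[z-y]⇒l*z≤x : ∀ {l x y z} → 0# ≤ y → l ≤ 1# → y ≤ x - l * (z - y) → l * z ≤ x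
  y≤x-l*[z-y]⇒l*z≤x {l} {x} {y} {z} 0≤y l≤1 y≤x-l[z-y] = begin
    l * z                        ≡⟨ x+[y-x]≡y (l * y) (l * z) ⟨
    l * y + (l * z - l * y)      ≡⟨ cong (l * y +_) (x[y-z]≈xy-xz l z y) ⟨
    l * y + l * (z - y)          ≤⟨ +-monoˡ-≤ (l * (z - y)) l*y≤y ⟩
    y + l * (z - y)              ≤⟨ +-monoˡ-≤ (l * (z - y)) y≤x-l[z-y] ⟩
    x - l * (z - y) + l * (z - y) ≡⟨ x-y+y≡x x (l * (z - y)) ⟩
    x                            ∎
    where
    l*y≤y : l * y ≤ y
    l*y≤y = subst₂ _≤_ refl (*-identityˡ y) (*-monoʳ-≤ 0≤y l≤1)

  u≤t*v+[1-t]*u⇒u≤v : ∀ {t u v} → 0# < t → u ≤ t * v + (1# - t) * u → u ≤ v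
  u≤t*v+[1-t]*u⇒u≤v {t} {u} {v} 0<t u≤ = 0≤y-x⇒x≤y (*-cancelˡ-≤ 0<t (begin
    t * 0#      ≡⟨ zeroʳ t ⟩
    0#          ≤⟨ +-cancelˡ-≤ u u+0≤u+t[v-u] ⟩
    t * (v - u) ∎))
    where
    u+0≤u+t[v-u] : u + 0# ≤ u + t * (v - u)
    u+0≤u+t[v-u] = subst₂ _≤_ (sym (+-identityʳ u)) (t*v+[1-t]*u≡u+t*[v-u] t u v) u≤

  Upto : (ℝ → Set) → ℝ → Set
  Upto P T = ∀ t → 0# ≤ t → t ≤ T → P t

  Upto-antitone : ∀ {P S T} → S ≤ T → Upto P T → Upto P S
  Upto-antitone S≤T P-upto-T t 0≤t t≤S = P-upto-T t 0≤t (≤-trans t≤S S≤T)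

  ¬¬-common-Upto : ∀ m (P : Fin m → ℝ → Set) →
    (∀ j → ¬ ¬ (∃[ T ] (0# < T × Upto (P j) T))) →
    ¬ ¬ (∃[ T ] (0# < T × T ≤ 1# × (∀ j → Upto (P j) T)))
  ¬¬-common-Upto zero    P _    = pure (1# , 0<1 , ≤-refl , λ ())
  ¬¬-common-Upto (suc m) P near = do
    (T₀ , 0<T₀ , P₀) ← near zero
    (T , 0<T , T≤1 , Pₛ) ← ¬¬-common-Upto m (P ∘ suc) (near ∘ suc)
    pure (smaller T₀ 0<T₀ P₀ T 0<T T≤1 Pₛ)
    where
    smaller : ∀ T₀ → 0# < T₀ → Upto (P zero) T₀ →
              ∀ T → 0# < T → T ≤ 1# → (∀ j → Upto (P (suc j)) T) →
              ∃[ T ] (0# < T × T ≤ 1# × (∀ j → Upto (P j) T))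
    smaller T₀ 0<T₀ P₀ T 0<T T≤1 Pₛ with total T₀ T
    ... | inj₁ T₀≤T = T₀ , 0<T₀ , ≤-trans T₀≤T T≤1 , λ { zero → P₀ ; (suc j) → Upto-antitone T₀≤T (Pₛ j) }
    ... | inj₂ T≤T₀ = T , 0<T , T≤1 , λ { zero → Upto-antitone T≤T₀ P₀ ; (suc j) → Pₛ j }

  t*v+[1-t]*u≤b-near-0 : ∀ {u v b} → u ≤ b → (u ≡ b → v ≤ b) →
    ¬ ¬ (∃[ T ] (0# < T × Upto (λ t → t * v + (1# - t) * u ≤ b) T))
  t*v+[1-t]*u≤b-near-0 {u} {v} {b} u≤b tight = ¬¬-map choose ¬¬-excluded-middle
    where
    Below : ℝ → Set
    Below t = t * v + (1# - t) * u ≤ b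

    everywhere : v ≤ b → ∃[ T ] (0# < T × Upto Below T)
    everywhere v≤b = 1# , 0<1 , λ t 0≤t t≤1 → begin
      t * v + (1# - t) * u ≤⟨ +-mono-≤ (*-monoˡ-≤ 0≤t v≤b) (*-monoˡ-≤ (x≤y⇒0≤y-x t≤1) u≤b) ⟩
      t * b + (1# - t) * b ≡⟨ t*x+[1-t]*x≡x t b ⟩
      b                    ∎

    -- When u < b ≤ v the bound holds up to the crossing point (b - u) / (v - u).
    crossing : ¬ u ≡ b → b ≤ v → ∃[ T ] (0# < T × Upto Below T)
    crossing u≢b b≤v = T , *-pos 0<s (invPos-pos 0<e) , below
      where
      s : ℝ
      s = b - u
      e : ℝ
      e = v - u
      0<s : 0# < s
      0<s = x≤y⇒0≤y-x u≤b , λ 0≡s → u≢b (begin-equality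
        u           ≡⟨ +-identityʳ u ⟨
        u + 0#      ≡⟨ cong (u +_) 0≡s ⟩
        u + (b - u) ≡⟨ x+[y-x]≡y u b ⟩
        b           ∎)
      s≤e : s ≤ e
      s≤e = +-monoˡ-≤ (- u) b≤v
      0<e : 0# < e
      0<e = ≤-trans (proj₁ 0<s) s≤e , λ 0≡e → proj₂ 0<s (≤-antisym (proj₁ 0<s) (subst (s ≤_) (sym 0≡e) s≤e))
      T : ℝ
      T = s * invPos e 0<e
      T*e≡s : T * e ≡ s
      T*e≡s = begin-equality
        s * invPos e 0<e * e   ≡⟨ *-assoc s (invPos e 0<e) e ⟩
        s * (invPos e 0<e * e) ≡⟨ cong (s *_) (*-comm (invPos e 0<e) e) ⟩
        s * (e * invPos e 0<e) ≡⟨ cong (s *_) (inv-r e _) ⟩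
        s * 1#                 ≡⟨ *-identityʳ s ⟩
        s                      ∎
      below : Upto Below T
      below t 0≤t t≤T = begin
        t * v + (1# - t) * u ≡⟨ t*v+[1-t]*u≡u+t*[v-u] t u v ⟩
        u + t * e            ≤⟨ +-monoʳ-≤ u (*-monoʳ-≤ (proj₁ 0<e) t≤T) ⟩
        u + T * e            ≡⟨ cong (u +_) T*e≡s ⟩
        u + s                ≡⟨ x+[y-x]≡y u b ⟩
        b                    ∎

    choose : Dec (u ≡ b) → ∃[ T ] (0# < T × Upto Below T)
    choose (yes u≡b) = everywhere (tight u≡b)
    choose (no u≢b) with total v b
    ... | inj₁ v≤b = everywhere v≤b
    ... | inj₂ b≤v = crossing u≢b b≤v

module GeometryProperties (F : RealField) where
  open Geometry F hiding (+-mono-≤)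
  open FieldProperties F

  private
    variable
      n : ℕ

  sum-cong : {f g : Fin n → ℝ} → (∀ i → f i ≡ g i) → sum f ≡ sum g
  sum-cong {zero}  f≗g = refl
  sum-cong {suc n} f≗g = cong₂ _+_ (f≗g zero) (sum-cong (f≗g ∘ suc))

  sum-+ : (f g : Fin n → ℝ) → sum (λ i → f i + g i) ≡ sum f + sum g
  sum-+ {zero}  f g = sym (+-identityʳ 0#)
  sum-+ {suc n} f g = trans (cong (f zero + g zero +_) (sum-+ (f ∘ suc) (g ∘ suc)))
                            (interchange (f zero) (g zero) (sum (f ∘ suc)) (sum (g ∘ suc)))

  sum-* : ∀ t (f : Fin n → ℝ) → sum (λ i → t * f i) ≡ t * sum f
  sum-* {zero}  t f = sym (zeroʳ t)
  sum-* {suc n} t f = trans (cong (t * f zero +_) (sum-* t (f ∘ suc))) (sym (distribˡ t (f zero) (sum (f ∘ suc))))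

  sum-neg : (f : Fin n → ℝ) → sum (λ i → - f i) ≡ - sum f
  sum-neg {zero}  f = sym -0#≈0#
  sum-neg {suc n} f = trans (cong (- f zero +_) (sum-neg (f ∘ suc))) (-‿+-comm (f zero) (sum (f ∘ suc)))

  sum-nonneg : {f : Fin n → ℝ} → (∀ i → 0# ≤ f i) → 0# ≤ sum f
  sum-nonneg {zero}  0≤f = ≤-refl
  sum-nonneg {suc n} 0≤f = subst₂ _≤_ (+-identityʳ 0#) refl (+-mono-≤ (0≤f zero) (sum-nonneg (0≤f ∘ suc)))

  ·-distrib-+ : (a u v : Vec n) → a · (λ i → u i + v i) ≡ a · u + a · v
  ·-distrib-+ a u v = trans (sum-cong (λ i → distribˡ (a i) (u i) (v i))) (sum-+ (λ i → a i * u i) (λ i → a i * v i))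

  ·-distrib-- : (a u v : Vec n) → a · (λ i → u i - v i) ≡ a · u - a · v
  ·-distrib-- a u v = begin-equality
    a · (λ i → u i - v i)                    ≡⟨ sum-cong (λ i → x[y-z]≈xy-xz (a i) (u i) (v i)) ⟩
    sum (λ i → a i * u i - a i * v i)        ≡⟨ sum-+ (λ i → a i * u i) (λ i → - (a i * v i)) ⟩
    a · u + sum (λ i → - (a i * v i))        ≡⟨ cong (a · u +_) (sum-neg (λ i → a i * v i)) ⟩
    a · u - a · v                            ∎

  ·-scale : (a : Vec n) (t : ℝ) (u : Vec n) → a · (λ i → t * u i) ≡ t * (a · u)
  ·-scale a t u = trans (sum-cong (λ i → x∙yz≈y∙xz (a i) t (u i))) (sum-* t (λ i → a i * u i))

  ·-nonneg : {a u : Vec n} → Nonneg a → Nonneg u → 0# ≤ a · u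
  ·-nonneg 0≤a 0≤u = sum-nonneg (λ i → *-nonneg (0≤a i) (0≤u i))

  ·-x-l*[z-y] : (a x : Vec n) (l : ℝ) (y z : Vec n) →
    a · (λ i → x i - l * (z i - y i)) ≡ a · x - l * (a · z - a · y)
  ·-x-l*[z-y] a x l y z = begin-equality
    a · (λ i → x i - l * (z i - y i))   ≡⟨ ·-distrib-- a x (λ i → l * (z i - y i)) ⟩
    a · x - a · (λ i → l * (z i - y i)) ≡⟨ cong (λ w → a · x - w) (·-scale a l (λ i → z i - y i)) ⟩
    a · x - l * (a · (λ i → z i - y i)) ≡⟨ cong (λ w → a · x - l * w) (·-distrib-- a z y) ⟩
    a · x - l * (a · z - a · y)         ∎

  segment : ℝ → Vec n → Vec n → Vec n
  segment t p y i = t * p i + (1# - t) * y i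

  ·-segment : (a : Vec n) (t : ℝ) (p y : Vec n) → a · segment t p y ≡ t * (a · p) + (1# - t) * (a · y)
  ·-segment a t p y = trans (·-distrib-+ a (λ i → t * p i) (λ i → (1# - t) * y i))
                            (cong₂ _+_ (·-scale a t p) (·-scale a (1# - t) y))

  Valid : Subset n → Vec n → ℝ → Set
  Valid Q a β = ∀ y → Q y → a · y ≤ β

  ¬¬-segment-in-polyhedron : ∀ {Q : Subset n} {y p} → IsPolyhedron Q → Q y →
    (∀ a β → Valid Q a β → a · y ≡ β → a · p ≤ β) →
    ¬ ¬ (∃[ T ] (0# < T × T ≤ 1# × Q (segment T p y)))
  ¬¬-segment-in-polyhedron {Q = Q} {y} {p} (m , A , b , Q⇔Ax≤b) y∈Q tight-stays =
    ¬¬-map enter (¬¬-common-Upto m _ (λ j → t*v+[1-t]*u≤b-near-0 (Ay≤b j) (tight-stays (A j) (b j) (valid j))))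
    where
    valid : ∀ j → Valid Q (A j) (b j)
    valid j w w∈Q = proj₁ (Q⇔Ax≤b w) w∈Q j
    Ay≤b : ∀ j → A j · y ≤ b j
    Ay≤b j = valid j y y∈Q
    enter : ∃[ T ] (0# < T × T ≤ 1# × (∀ j → Upto (λ t → t * (A j · p) + (1# - t) * (A j · y) ≤ b j) T)) →
            ∃[ T ] (0# < T × T ≤ 1# × Q (segment T p y))
    enter (T , 0<T , T≤1 , rows) = T , 0<T , T≤1 , proj₂ (Q⇔Ax≤b (segment T p y))
      (λ j → subst₂ _≤_ (sym (·-segment (A j) T p y)) refl (rows j T (proj₁ 0<T) ≤-refl))

  x-l·R-convex : ∀ {R : Subset n} x l → IsConvex R → IsConvex (x - l ·R R)
  x-l·R-convex x l R-convex w₁ w₂ t (r , r∈R , w₁≡x-lr) (s , s∈R , w₂≡x-ls) 0≤t t≤1 =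
    (λ i → t * r i + (1# - t) * s i) , R-convex r s t r∈R s∈R 0≤t t≤1 , λ i →
      trans (cong₂ (λ u v → t * u + (1# - t) * v) (w₁≡x-lr i) (w₂≡x-ls i))
            (t*[x-l*r]+[1-t]*[x-l*s]≡x-l*[t*r+[1-t]*s] t (x i) l (r i) (s i))

  InMinimalFace⇒valid-at-x-l*[z-y] : ∀ {Q : Subset n} {x y z a β} l → Q x → InMinimalFace Q y z →
    Valid Q a β → a · y ≡ β → a · (λ i → x i - l * (z i - y i)) ≤ β
  InMinimalFace⇒valid-at-x-l*[z-y] {x = x} {y} {z} {a} {β} l x∈Q (_ , face) valid ay≡β = begin
    a · (λ i → x i - l * (z i - y i)) ≡⟨ ·-x-l*[z-y] a x l y z ⟩
    a · x - l * (a · z - a · y)       ≡⟨ cong₂ (λ u v → a · x - l * (u - v)) (face a β valid ay≡β) ay≡β ⟩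
    a · x - l * (β - β)               ≡⟨ cong (λ w → a · x - l * w) (-‿inverseʳ β) ⟩
    a · x - l * 0#                    ≡⟨ cong (λ w → a · x - w) (zeroʳ l) ⟩
    a · x - 0#                        ≡⟨ cong (a · x +_) -0#≈0# ⟩
    a · x + 0#                        ≡⟨ +-identityʳ (a · x) ⟩
    a · x                             ≤⟨ valid x x∈Q ⟩
    β                                 ∎

  minimum-along-segment : ∀ {S : Subset n} {c y p} → (∀ w → S w → c · y ≤ c · w) →
    ¬ ¬ (∃[ T ] (0# < T × S (segment T p y))) → c · y ≤ c · p
  minimum-along-segment {S = S} {c} {y} {p} minimal segment-in-S = ≤-stable (¬¬-map step segment-in-S)
    where
    step : ∃[ T ] (0# < T × S (segment T p y)) → c · y ≤ c · p
    step (T , 0<T , w∈S) = u≤t*v+[1-t]*u⇒u≤v 0<T (subst₂ _≤_ refl (·-segment c T p y) (minimal _ w∈S))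

corollary2p3 :
    (F : RealField) → let open Geometry F in
    (n : ℕ) (c : Vec n) → Nonneg c →
    (l : ℝ) (l>0 : 0# < l) → l ≤ 1# →
    (Q : Subset n) → IsPolyhedron Q → (∀ y → Q y → Nonneg y) →
    (Z : Subset n) → Z ⊆ Q →
    (R : Subset n) → IsConvex R → R zeroV →
    (alg : (y : Vec n) → Q y → Vec n) → IsFPRA Q Z R alg →
    (x : Vec n) → Q x →
    (y* : Vec n) (qy : Q y*) → (x - l ·R R) y* →
    (∀ y → Q y → (x - l ·R R) y → c · y* ≤ c · y) →
    (c · alg y* qy ≤ invPos l l>0 * (c · x))
      × (x +[ R - l · R ]) (alg y* qy)
corollary2p3 F n c 0≤c l 0<l l≤1 Q Q-polyhedron Q≥0 _ _ R R-convex _ alg alg-FPRA x x∈Q y y∈Q y∈x-lR@(r₂ , r₂∈R , y≡x-lr₂) y-optimal =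
  x*y≤z⇒y≤x⁻¹*z 0<l (y≤x-l*[z-y]⇒l*z≤x (·-nonneg 0≤c (Q≥0 y y∈Q)) l≤1 cy≤cx-l[cz-cy]) ,
  (r₁ , r₂ , r₁∈R , r₂∈R , λ i → y≡x-w⇒z≡x+[z-y]-w (y≡x-lr₂ i))
  where
  open Geometry F hiding (+-mono-≤)
  open FieldProperties F
  open GeometryProperties F
  z : Vec n
  z = alg y y∈Q
  r₁ : Vec n
  r₁ i = z i - y i
  r₁∈R : R r₁
  r₁∈R = proj₁ (proj₂ (alg-FPRA y y∈Q))
  p : Vec n
  p i = x i - l * r₁ i
  p∈x-lR : (x - l ·R R) p
  p∈x-lR = r₁ , r₁∈R , λ i → refl

  Feasible : Subset n
  Feasible w = Q w × (x - l ·R R) w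

  feasible-near-y : ¬ ¬ (∃[ T ] (0# < T × Feasible (segment T p y)))
  feasible-near-y = ¬¬-map
    (λ (T , 0<T , T≤1 , w∈Q) → T , 0<T , w∈Q , x-l·R-convex x l R-convex p y T p∈x-lR y∈x-lR (proj₁ 0<T) T≤1)
    (¬¬-segment-in-polyhedron Q-polyhedron y∈Q (λ a β → InMinimalFace⇒valid-at-x-l*[z-y] l x∈Q (proj₂ (proj₂ (alg-FPRA y y∈Q)))))

  cy≤cx-l[cz-cy] : c · y ≤ c · x - l * (c · z - c · y)
  cy≤cx-l[cz-cy] = subst (c · y ≤_) (·-x-l*[z-y] c x l y z)
    (minimum-along-segment {S = Feasible} {c} {y} {p} (λ w (w∈Q , w∈x-lR) → y-optimal w w∈Q w∈x-lR) feasible-near-y)
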